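{- Let $G$ be a group of order $n$ with identity $e$ and let $U\subseteq G\setminus\{e\}$ be symmetric. Suppose the adjacency matrix of the Cayley graph $X=\mathsf{Cay}(G;U)$ factors as $A(X)=A(Y)A(Z)$, where $Y,Z$ are simple graphs (no loops, no multiple edges) on the vertex set $G$ and $A(\cdot)$ denotes the adjacency matrix with respect to a common ordering of $G$. If $n=2(2t+1)$ for some integer $t$, then $U$ contains an even number of elements of order $2$.
   Context: A subset $U$ is symmetric if $U^{ -1}=U$. $\mathsf{Cay}(G;U)$ is the graph with vertex set $G$ and $g\sim h$ iff $g^{ -1}h\in U$. -}

module Defs where

open import Data.Nat using (ℕ; _+_; _*_)
open import Data.Bool using (Bool; true; false; _∧_; not; if_then_else_)
open import Data.Fin using (Fin; _≟_)
open import Data.List using (List; map; allFin)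
open import Data.Nat.ListAction using (sum)
open import Relation.Nullary.Decidable using (⌊_⌋)
open import Relation.Binary.PropositionalEquality using (_≡_)

ind : Bool → ℕ
ind b = if b then 1 else 0

sumFin : (n : ℕ) → (Fin n → ℕ) → ℕ
sumFin n f = sum (map f (allFin n))

hasOrder2 : {n : ℕ} → (Fin n → Fin n → Fin n) → Fin n → Fin n → Bool
hasOrder2 _∙_ ε g = not ⌊ g ≟ ε ⌋ ∧ ⌊ (g ∙ g) ≟ ε ⌋

countOrder2In : (n : ℕ) → (Fin n → Fin n → Fin n) → Fin n → (Fin n → Bool) → ℕ
countOrder2In n _∙_ ε U = sumFin n (λ g → ind (U g ∧ hasOrder2 _∙_ ε g))

record IsSimpleGraph {n : ℕ} (A : Fin n → Fin n → Bool) : Set where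
  field
    sym-adj  : ∀ i j → A i j ≡ A j i
    loopless : ∀ i → A i i ≡ false

{-# OPTIONS --safe #-}
-- A(X) = A(Y) A(Z) is a 0/1 matrix, so for every arc (g , h) of X there is exactly one vertex
-- mid g h with g ~Y mid g h ~Z h.  The vertices g, mid g h, h, mid h g then form a 4-cycle
-- alternating between Y and Z whose two diagonals, {g , h} and {mid g h , mid h g}, are both
-- edges of X.  Reversal and passing to the other diagonal are commuting involutions on the arcs
-- of X that generate a free action of Z/2 × Z/2, so 4 divides the number n |U| of arcs.  As
-- n ≡ 2 mod 4, |U| is even; the elements of U that are not self-inverse pair off with their
-- inverses, so the number of elements of order 2 is even as well.

module Submission where

open import Defs
open import Level using (0ℓ)
open import Data.Nat using (ℕ; zero; suc; _+_; _*_; _≤_; s≤s; z≤n)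
open import Data.Nat.Properties
  using (+-0-commutativeMonoid; +-assoc; +-comm; +-identityʳ; *-assoc; *-comm; *-distribʳ-+; *-identityˡ;
         m≤m+n; +-monoʳ-≤; ≤-trans; ≤-reflexive; 1+n≰n; module ≤-Reasoning)
open import Data.Nat.Divisibility using (_∣_; divides; ∣m+n∣m⇒∣n; *-cancelˡ-∣; m∣m*n; ∣-trans)
import Data.Nat.ListAction as List
open import Data.Bool using (Bool; true; false; _∧_; not; if_then_else_)
import Data.Bool as Bool
open import Data.Bool.Properties using (∧-zeroʳ; ¬-not)
open import Data.Fin using (Fin; zero; suc; _≟_; _<?_; _↑ˡ_; _↑ʳ_; combine; remQuot; punchIn; punchOut)
open import Data.Fin.Properties using (<-cmp; any?; punchIn-punchOut; remQuot-combine; *↔×)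
open import Data.Fin.Permutation using (Permutation; permutation)
open import Data.List using (tabulate)
open import Data.List.Properties using (map-tabulate)
open import Data.Product using (_×_; _,_; proj₁; proj₂; swap; uncurry)
open import Function using (_∘_; id; _↔_; Inverse; _⇔_; mk⇔)
open import Function.Construct.Identity using (↔-id)
open import Relation.Binary using (tri<; tri≈; tri>)
open import Relation.Binary.PropositionalEquality
open import Relation.Nullary using (Dec; does; yes; no; contradiction)
open import Relation.Nullary.Decidable using (⌊_⌋; _×-dec_; dec-true; dec-false; isYes≗does; does-⇔)
open import Algebra.Bundles using (Group)
open import Algebra.Structures using (IsGroup)
import Algebra.Properties.Group as GroupProperties
open import Algebra.Properties.CommutativeMonoid.Sum +-0-commutativeMonoid
  using (sum-syntax; sum-remove; sum-cong-≗; sum-replicate-zero; ∑-distrib-+; ∑-permute)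

∧-true⁻ : ∀ {a b} → a ∧ b ≡ true → a ≡ true × b ≡ true
∧-true⁻ {true} {true} refl = refl , refl

∧-true⁺ : ∀ {a b} → a ≡ true → b ≡ true → a ∧ b ≡ true
∧-true⁺ refl refl = refl

ind-∧-not : ∀ a b → ind a ≡ ind (a ∧ b) + ind (a ∧ not b)
ind-∧-not true true = refl
ind-∧-not true false = refl
ind-∧-not false b = refl

ind-∧ : ∀ a b → ind (a ∧ b) ≡ ind a * ind b
ind-∧ true true = refl
ind-∧ true false = refl
ind-∧ false b = refl

ind≤1 : ∀ b → ind b ≤ 1
ind≤1 true = s≤s z≤n
ind≤1 false = z≤n

1≤ind⇒true : ∀ {b} → 1 ≤ ind b → b ≡ true
1≤ind⇒true {true} _ = refl

⌊⌋-⇔ : ∀ {A B : Set} → A ⇔ B → (a? : Dec A) (b? : Dec B) → ⌊ a? ⌋ ≡ ⌊ b? ⌋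
⌊⌋-⇔ A⇔B a? b? = trans (isYes≗does a?) (trans (does-⇔ A⇔B a? b?) (sym (isYes≗does b?)))

∑-tabulate : ∀ {N} (f : Fin N → ℕ) → List.sum (tabulate f) ≡ ∑[ i < N ] f i
∑-tabulate {zero} f = refl
∑-tabulate {suc N} f = cong (f zero +_) (∑-tabulate (f ∘ suc))

sumFin≡∑ : ∀ N (f : Fin N → ℕ) → sumFin N f ≡ ∑[ i < N ] f i
sumFin≡∑ N f = trans (cong List.sum (map-tabulate id f)) (∑-tabulate f)

term≤∑ : ∀ {N} (f : Fin N → ℕ) i → f i ≤ ∑[ j < N ] f j
term≤∑ {suc N} f i = ≤-trans (m≤m+n (f i) _) (≤-reflexive (sym (sum-remove {i = i} f)))

two-terms≤∑ : ∀ {N} (f : Fin N → ℕ) {i j} → i ≢ j → f i + f j ≤ ∑[ k < N ] f k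
two-terms≤∑ {suc N} f {i} {j} i≢j = begin
  f i + f j                                     ≡⟨ cong (λ k → f i + f k) (punchIn-punchOut i≢j) ⟨
  f i + f (punchIn i (punchOut i≢j))            ≤⟨ +-monoʳ-≤ (f i) (term≤∑ (f ∘ punchIn i) (punchOut i≢j)) ⟩
  f i + ∑[ k < N ] f (punchIn i k)              ≡⟨ sum-remove {i = i} f ⟨
  ∑[ k < suc N ] f k                            ∎
  where open ≤-Reasoning

∑-↑ : ∀ m n (f : Fin (m + n) → ℕ)
    → ∑[ i < m + n ] f i ≡ ∑[ i < m ] f (i ↑ˡ n) + ∑[ j < n ] f (m ↑ʳ j)
∑-↑ zero n f = refl
∑-↑ (suc m) n f = trans (cong (f zero +_) (∑-↑ m n (f ∘ suc))) (sym (+-assoc (f zero) _ _))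

∑-combine : ∀ m n (f : Fin (m * n) → ℕ)
          → ∑[ k < m * n ] f k ≡ ∑[ i < m ] ∑[ j < n ] f (combine i j)
∑-combine zero n f = refl
∑-combine (suc m) n f =
  trans (∑-↑ n (m * n) f) (cong (∑[ j < n ] f (j ↑ˡ (m * n)) +_) (∑-combine m n (f ∘ (n ↑ʳ_))))

∑-const : ∀ N c → ∑[ i < N ] c ≡ N * c
∑-const zero c = refl
∑-const (suc N) c = cong (c +_) (∑-const N c)

4∣[2*[2*t+1]]*m⇒2∣m : ∀ t m → 4 ∣ 2 * (2 * t + 1) * m → 2 ∣ m
4∣[2*[2*t+1]]*m⇒2∣m t m 4∣n*m =
  ∣m+n∣m⇒∣n (subst (2 ∣_) odd*m≡2tm+m 2∣odd*m) (∣-trans (m∣m*n t) (m∣m*n m))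
  where
  2∣odd*m : 2 ∣ (2 * t + 1) * m
  2∣odd*m = *-cancelˡ-∣ 2 (subst (4 ∣_) (*-assoc 2 (2 * t + 1) m) 4∣n*m)
  odd*m≡2tm+m : (2 * t + 1) * m ≡ 2 * t * m + m
  odd*m≡2tm+m = trans (*-distribʳ-+ m (2 * t) 1) (cong (2 * t * m +_) (*-identityˡ m))

module Counting {A : Set} {N : ℕ} (enum : Fin N ↔ A) where
  open Inverse enum using (to; from; strictlyInverseˡ; strictlyInverseʳ)

  count : (A → Bool) → ℕ
  count p = ∑[ i < N ] ind (p (to i))

  count-cong : ∀ {p q : A → Bool} → (∀ x → p x ≡ q x) → count p ≡ count q
  count-cong p≗q = sum-cong-≗ (λ i → cong ind (p≗q (to i)))

  count-∧-not : ∀ (p c : A → Bool)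
              → count p ≡ count (λ x → p x ∧ c x) + count (λ x → p x ∧ not (c x))
  count-∧-not p c = trans (sum-cong-≗ (λ i → ind-∧-not (p (to i)) (c (to i))))
    (∑-distrib-+ (λ i → ind (p (to i) ∧ c (to i))) (λ i → ind (p (to i) ∧ not (c (to i)))))

  count-∘-inverse : ∀ (p : A → Bool) (f g : A → A) → (∀ x → f (g x) ≡ x) → (∀ x → g (f x) ≡ x)
                  → count (p ∘ f) ≡ count p
  count-∘-inverse p f g fg gf = begin
    count (p ∘ f)                              ≡⟨ count-cong (cong p ∘ sym ∘ strictlyInverseˡ ∘ f) ⟩
    ∑[ i < N ] ind (p (to (from (f (to i)))))  ≡⟨ ∑-permute (λ i → ind (p (to i))) π ⟨
    count p                                    ∎
    where
    open ≡-Reasoning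
    lift : (A → A) → Fin N → Fin N
    lift h = from ∘ h ∘ to
    lift-inverse : ∀ h k → (∀ x → h (k x) ≡ x) → ∀ i → lift h (lift k i) ≡ i
    lift-inverse h k hk i = begin
      from (h (to (from (k (to i)))))  ≡⟨ cong (from ∘ h) (strictlyInverseˡ (k (to i))) ⟩
      from (h (k (to i)))              ≡⟨ cong from (hk (to i)) ⟩
      from (to i)                      ≡⟨ strictlyInverseʳ i ⟩
      i                                ∎
    π : Permutation N N
    π = permutation (lift f) (lift g) (lift-inverse f g fg) (lift-inverse g f gf)

  _≺_ : A → A → Bool
  x ≺ y = does (from x <? from y)

  ≺-flip : ∀ {x y} → x ≢ y → y ≺ x ≡ not (x ≺ y)
  ≺-flip {x} {y} x≢y with <-cmp (from x) (from y)
  ... | tri< x<y _ y≮x =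
    trans (dec-false (from y <? from x) y≮x) (cong not (sym (dec-true (from x <? from y) x<y)))
  ... | tri≈ _ x≡y _ =
    contradiction (trans (sym (strictlyInverseˡ x)) (trans (cong to x≡y) (strictlyInverseˡ y))) x≢y
  ... | tri> x≮y _ y<x =
    trans (dec-true (from y <? from x) y<x) (cong not (sym (dec-false (from x <? from y) x≮y)))

  record IsInvolutionOn (p : A → Bool) (σ : A → A) : Set where
    field
      closed     : ∀ {x} → p x ≡ true → p (σ x) ≡ true
      involutive : ∀ {x} → p x ≡ true → σ (σ x) ≡ x

  record IsFreeInvolutionOn (p : A → Bool) (σ : A → A) : Set where
    field
      isInvolutionOn : IsInvolutionOn p σ
      fixpointFree   : ∀ {x} → p x ≡ true → σ x ≢ x
    open IsInvolutionOn isInvolutionOn public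

  extend : (A → Bool) → (A → A) → A → A
  extend p σ x = if p x then σ x else x

  extend-involutive : ∀ {p σ} → IsInvolutionOn p σ → ∀ x → extend p σ (extend p σ x) ≡ x
  extend-involutive {p} {σ} inv x with p x in px
  ... | true rewrite IsInvolutionOn.closed inv px = IsInvolutionOn.involutive inv px
  ... | false rewrite px = refl

  count-transversal : ∀ {p σ} (c : A → Bool) → IsInvolutionOn p σ
                    → (∀ {x} → p x ≡ true → c (σ x) ≡ not (c x))
                    → count p ≡ 2 * count (λ x → p x ∧ c x)
  count-transversal {p} {σ} c inv c-flip = begin
    count p                                           ≡⟨ sum-cong-≗ (split ∘ to) ⟩
    ∑[ i < N ] (ind (q (to i)) + ind (q (σ̂ (to i))))  ≡⟨ ∑-distrib-+ (ind ∘ q ∘ to) (ind ∘ q ∘ σ̂ ∘ to) ⟩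
    count q + count (q ∘ σ̂)                           ≡⟨ cong (count q +_) count-q∘σ̂ ⟩
    count q + count q                                 ≡⟨ cong (count q +_) (+-identityʳ (count q)) ⟨
    2 * count q                                       ∎
    where
    open ≡-Reasoning
    q : A → Bool
    q x = p x ∧ c x
    σ̂ : A → A
    σ̂ = extend p σ
    σ̂-inv : ∀ x → σ̂ (σ̂ x) ≡ x
    σ̂-inv = extend-involutive inv
    count-q∘σ̂ : count (q ∘ σ̂) ≡ count q
    count-q∘σ̂ = count-∘-inverse q σ̂ σ̂ σ̂-inv σ̂-inv
    split : ∀ x → ind (p x) ≡ ind (q x) + ind (q (σ̂ x))
    split x with p x in px
    ... | true rewrite IsInvolutionOn.closed inv px | c-flip px = ind-∧-not true (c x)
    ... | false rewrite px = refl

  count-freeInvolution : ∀ {p σ} → IsFreeInvolutionOn p σ → count p ≡ 2 * count (λ x → p x ∧ x ≺ σ x)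
  count-freeInvolution {p} {σ} free = count-transversal (λ x → x ≺ σ x) isInvolutionOn ≺-flip-σ
    where
    open IsFreeInvolutionOn free
    ≺-flip-σ : ∀ {x} → p x ≡ true → σ x ≺ σ (σ x) ≡ not (x ≺ σ x)
    ≺-flip-σ px rewrite involutive px = ≺-flip (fixpointFree px ∘ sym)

  4∣count-freeKlein : ∀ {p σ τ} → IsFreeInvolutionOn p σ → IsFreeInvolutionOn p τ
                    → (∀ {x} → p x ≡ true → σ (τ x) ≡ τ (σ x))
                    → (∀ {x} → p x ≡ true → σ (τ x) ≢ x)
                    → 4 ∣ count p
  4∣count-freeKlein {p} {σ} {τ} σ-free τ-free σ∘τ≡τ∘σ σ∘τ-free = divides (count r) (begin
    count p            ≡⟨ count-freeInvolution σ-free ⟩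
    2 * count q        ≡⟨ cong (2 *_) (count-freeInvolution ρ-free) ⟩
    2 * (2 * count r)  ≡⟨ *-assoc 2 2 (count r) ⟨
    4 * count r        ≡⟨ *-comm 4 (count r) ⟩
    count r * 4        ∎)
    where
    open ≡-Reasoning
    module σ = IsFreeInvolutionOn σ-free
    module τ = IsFreeInvolutionOn τ-free

    q : A → Bool
    q x = p x ∧ x ≺ σ x

    -- of τ x and σ (τ x), the one below its σ-partner: τ acting on σ-orbits through representatives
    ρ : A → A
    ρ x = if τ x ≺ σ (τ x) then τ x else σ (τ x)

    r : A → Bool
    r x = q x ∧ x ≺ ρ x

    ρ-free : IsFreeInvolutionOn q ρ
    ρ-free = record
      { isInvolutionOn = record { closed = ρ-closed ∘ ∧-true⁻ ; involutive = ρ-involutive ∘ ∧-true⁻ }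
      ; fixpointFree   = ρ-fixpointFree ∘ proj₁ ∘ ∧-true⁻
      }
      where
      ρ-closed : ∀ {x} → p x ≡ true × x ≺ σ x ≡ true → q (ρ x) ≡ true
      ρ-closed {x} (px , _) with τ x ≺ σ (τ x) in τx≺στx
      ... | true rewrite τ.closed px = τx≺στx
      ... | false rewrite σ.closed (τ.closed px) | σ.involutive (τ.closed px) =
        trans (≺-flip (σ.fixpointFree (τ.closed px) ∘ sym)) (cong not τx≺στx)

      τ∘σ∘τ≡σ : ∀ {x} → p x ≡ true → τ (σ (τ x)) ≡ σ x
      τ∘σ∘τ≡σ px = trans (cong τ (σ∘τ≡τ∘σ px)) (τ.involutive (σ.closed px))

      σx⊀x : ∀ {x} → p x ≡ true → x ≺ σ x ≡ true → σ x ≺ x ≡ false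
      σx⊀x px x≺σx = trans (≺-flip (σ.fixpointFree px ∘ sym)) (cong not x≺σx)

      ρ-involutive : ∀ {x} → p x ≡ true × x ≺ σ x ≡ true → ρ (ρ x) ≡ x
      ρ-involutive {x} (px , x≺σx) with τ x ≺ σ (τ x)
      ... | true rewrite τ.involutive px | x≺σx = refl
      ... | false rewrite τ∘σ∘τ≡σ px | σ.involutive px | σx⊀x px x≺σx = refl

      ρ-fixpointFree : ∀ {x} → p x ≡ true → ρ x ≢ x
      ρ-fixpointFree {x} px with τ x ≺ σ (τ x)
      ... | true = τ.fixpointFree px
      ... | false = σ∘τ-free px

  2∣count-freeInvolution : ∀ {p σ} → IsFreeInvolutionOn p σ → 2 ∣ count p
  2∣count-freeInvolution {p} {σ} free = divides half (trans (count-freeInvolution free) (*-comm 2 half))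
    where
    half : ℕ
    half = count (λ x → p x ∧ x ≺ σ x)

count-*↔× : ∀ {m n} (P : Fin m × Fin n → Bool)
          → Counting.count *↔× P ≡ ∑[ i < m ] ∑[ j < n ] ind (P (i , j))
count-*↔× {m} {n} P = trans (∑-combine m n (λ k → ind (P (remQuot n k))))
  (sum-cong-≗ λ i → sum-cong-≗ λ j → cong (ind ∘ P) (remQuot-combine i j))

module SimpleGraphFactorisation {n : ℕ} {X Y Z : Fin n → Fin n → Bool}
  (X-simple : IsSimpleGraph X) (Y-simple : IsSimpleGraph Y) (Z-simple : IsSimpleGraph Z)
  (X≡Y*Z : ∀ g h → ind (X g h) ≡ ∑[ k < n ] (ind (Y g k) * ind (Z k h))) where

  open Counting (↔-id (Fin n)) using (count)
  private
    module X = IsSimpleGraph X-simple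
    module Y = IsSimpleGraph Y-simple
    module Z = IsSimpleGraph Z-simple

  X-sym : ∀ {g h} → X g h ≡ true → X h g ≡ true
  X-sym {g} {h} adj = trans (X.sym-adj h g) adj

  path : Fin n → Fin n → Fin n → Bool
  path g h k = Y g k ∧ Z k h

  ind-adj≡count-path : ∀ g h → ind (X g h) ≡ count (path g h)
  ind-adj≡count-path g h = trans (X≡Y*Z g h) (sum-cong-≗ (λ k → sym (ind-∧ (Y g k) (Z k h))))

  path⇒adj : ∀ {g h k} → path g h k ≡ true → X g h ≡ true
  path⇒adj {g} {h} {k} pk = 1≤ind⇒true (begin
    1                   ≡⟨ cong ind pk ⟨
    ind (path g h k)    ≤⟨ term≤∑ (ind ∘ path g h) k ⟩
    count (path g h)    ≡⟨ ind-adj≡count-path g h ⟨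
    ind (X g h)         ∎)
    where open ≤-Reasoning

  path-unique : ∀ {g h k k′} → path g h k ≡ true → path g h k′ ≡ true → k ≡ k′
  path-unique {g} {h} {k} {k′} pk pk′ with k ≟ k′
  ... | yes k≡k′ = k≡k′
  ... | no k≢k′ = contradiction (begin
    2                                    ≡⟨ cong₂ (λ a b → ind a + ind b) pk pk′ ⟨
    ind (path g h k) + ind (path g h k′)  ≤⟨ two-terms≤∑ (ind ∘ path g h) k≢k′ ⟩
    count (path g h)                     ≡⟨ ind-adj≡count-path g h ⟨
    ind (X g h)                          ≤⟨ ind≤1 (X g h) ⟩
    1                                    ∎) (1+n≰n {1})
    where open ≤-Reasoning

  mid : Fin n → Fin n → Fin n
  mid g h with any? (λ k → (Y g k Bool.≟ true) ×-dec (Z k h Bool.≟ true))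
  ... | yes (k , _) = k
  ... | no _ = g  -- junk value: g and h are not adjacent

  mid-path : ∀ {g h} → X g h ≡ true → Y g (mid g h) ≡ true × Z (mid g h) h ≡ true
  mid-path {g} {h} adj with any? (λ k → (Y g k Bool.≟ true) ×-dec (Z k h Bool.≟ true))
  ... | yes (_ , pk) = pk
  ... | no no-path = contradiction (begin
    1                 ≡⟨ cong ind adj ⟨
    ind (X g h)       ≡⟨ ind-adj≡count-path g h ⟩
    count (path g h)  ≡⟨ sum-cong-≗ (λ k → cong ind (¬-not (λ pk → no-path (k , ∧-true⁻ pk)))) ⟩
    ∑[ k < n ] 0      ≡⟨ sum-replicate-zero n ⟩
    0                 ∎) λ ()
    where open ≡-Reasoning

  mid-unique : ∀ {g h k} → path g h k ≡ true → mid g h ≡ k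
  mid-unique pk = path-unique (uncurry ∧-true⁺ (mid-path (path⇒adj pk))) pk

  path-mid-mid : ∀ {g h} → X g h ≡ true → path (mid g h) (mid h g) g ≡ true
  path-mid-mid {g} {h} adj = ∧-true⁺
    (trans (Y.sym-adj (mid g h) g) (proj₁ (mid-path adj)))
    (trans (Z.sym-adj g (mid h g)) (proj₂ (mid-path (X-sym adj))))

  mid-mid : ∀ {g h} → X g h ≡ true → mid (mid g h) (mid h g) ≡ g
  mid-mid adj = mid-unique (path-mid-mid adj)

  adj-mid-mid : ∀ {g h} → X g h ≡ true → X (mid g h) (mid h g) ≡ true
  adj-mid-mid adj = path⇒adj (path-mid-mid adj)

  mid≢source : ∀ {g h} → X g h ≡ true → mid g h ≢ g
  mid≢source {g} {h} adj k≡g = contradiction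
    (trans (sym (proj₁ (mid-path adj))) (trans (cong (Y g) k≡g) (Y.loopless g))) λ ()

  mid≢target : ∀ {g h} → X g h ≡ true → mid g h ≢ h
  mid≢target {g} {h} adj k≡h = contradiction
    (trans (sym (proj₂ (mid-path adj))) (trans (cong (λ k → Z k h) k≡h) (Z.loopless h))) λ ()

  open Counting (*↔× {n} {n}) using (IsFreeInvolutionOn; 4∣count-freeKlein)

  arc : Fin n × Fin n → Bool
  arc (g , h) = X g h

  otherDiagonal : Fin n × Fin n → Fin n × Fin n
  otherDiagonal (g , h) = mid g h , mid h g

  swap-free : IsFreeInvolutionOn arc swap
  swap-free = record
    { isInvolutionOn = record { closed = X-sym ; involutive = λ _ → refl }
    ; fixpointFree   = loop
    }
    where
    loop : ∀ {x} → arc x ≡ true → swap x ≢ x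
    loop {g , h} adj hg≡gh =
      contradiction (trans (sym adj) (trans (cong (X g) (cong proj₁ hg≡gh)) (X.loopless g))) λ ()

  otherDiagonal-free : IsFreeInvolutionOn arc otherDiagonal
  otherDiagonal-free = record
    { isInvolutionOn = record
        { closed     = adj-mid-mid
        ; involutive = λ adj → cong₂ _,_ (mid-mid adj) (mid-mid (X-sym adj))
        }
    ; fixpointFree   = λ adj → mid≢source adj ∘ cong proj₁
    }

  4∣count-arcs : 4 ∣ ∑[ g < n ] ∑[ h < n ] ind (X g h)
  4∣count-arcs = subst (4 ∣_) (count-*↔× arc)
    (4∣count-freeKlein swap-free otherDiagonal-free (λ _ → refl)
      (λ adj → mid≢target (X-sym adj) ∘ cong proj₁))

module CayleyGraph {n : ℕ} {_∙_ : Fin n → Fin n → Fin n} {ε : Fin n} {_⁻¹ : Fin n → Fin n}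
  (isGroup : IsGroup _≡_ _∙_ ε _⁻¹)
  (U : Fin n → Bool) (U-sym : ∀ g → U (g ⁻¹) ≡ U g) (ε∉U : U ε ≡ false) where

  group : Group 0ℓ 0ℓ
  group = record { _≈_ = _≡_ ; _∙_ = _∙_ ; ε = ε ; _⁻¹ = _⁻¹ ; isGroup = isGroup }

  open IsGroup isGroup using (inverseˡ; inverseʳ)
  open GroupProperties group
    using (⁻¹-anti-homo-∙; ⁻¹-involutive; inverseˡ-unique; \\-leftDividesˡ; \\-leftDividesʳ)
  open Counting (↔-id (Fin n))
    using (count; count-cong; count-∧-not; count-∘-inverse; IsFreeInvolutionOn; 2∣count-freeInvolution)

  cayley : Fin n → Fin n → Bool
  cayley g h = U ((g ⁻¹) ∙ h)

  cayley-isSimpleGraph : IsSimpleGraph cayley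
  cayley-isSimpleGraph = record { sym-adj = sym-adj ; loopless = λ g → trans (cong U (inverseˡ g)) ε∉U }
    where
    sym-adj : ∀ g h → U ((g ⁻¹) ∙ h) ≡ U ((h ⁻¹) ∙ g)
    sym-adj g h = begin
      U ((g ⁻¹) ∙ h)           ≡⟨ U-sym ((g ⁻¹) ∙ h) ⟨
      U (((g ⁻¹) ∙ h) ⁻¹)      ≡⟨ cong U (⁻¹-anti-homo-∙ (g ⁻¹) h) ⟩
      U ((h ⁻¹) ∙ ((g ⁻¹) ⁻¹))   ≡⟨ cong (λ x → U ((h ⁻¹) ∙ x)) (⁻¹-involutive g) ⟩
      U ((h ⁻¹) ∙ g)           ∎
      where open ≡-Reasoning

  count-arcs : ∑[ g < n ] ∑[ h < n ] ind (cayley g h) ≡ n * count U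
  count-arcs = trans (sum-cong-≗ count-row) (∑-const n (count U))
    where
    count-row : ∀ g → count (cayley g) ≡ count U
    count-row g = count-∘-inverse U ((g ⁻¹) ∙_) (g ∙_) (\\-leftDividesʳ g) (\\-leftDividesˡ g)

  selfInverse : Fin n → Bool
  selfInverse g = ⌊ g ⁻¹ ≟ g ⌋

  x∙x≡ε⇔x⁻¹≡x : ∀ x → (x ∙ x ≡ ε) ⇔ (x ⁻¹ ≡ x)
  x∙x≡ε⇔x⁻¹≡x x = mk⇔ (sym ∘ inverseˡ-unique x x)
    (λ x⁻¹≡x → trans (cong (x ∙_) (sym x⁻¹≡x)) (inverseʳ x))

  order2≡selfInverse : ∀ g → U g ∧ hasOrder2 _∙_ ε g ≡ U g ∧ selfInverse g
  order2≡selfInverse g with g ≟ ε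
  ... | yes refl rewrite ε∉U = refl
  ... | no _ = cong (U g ∧_) (⌊⌋-⇔ (x∙x≡ε⇔x⁻¹≡x g) ((g ∙ g) ≟ ε) (g ⁻¹ ≟ g))

  countOrder2≡count-selfInverse : countOrder2In n _∙_ ε U ≡ count (λ g → U g ∧ selfInverse g)
  countOrder2≡count-selfInverse = trans (sumFin≡∑ n _) (count-cong order2≡selfInverse)

  2∣count-nonSelfInverse : 2 ∣ count (λ g → U g ∧ not (selfInverse g))
  2∣count-nonSelfInverse = 2∣count-freeInvolution ⁻¹-free
    where
    p : Fin n → Bool
    p g = U g ∧ not (selfInverse g)
    p-⁻¹ : ∀ g → p (g ⁻¹) ≡ p g
    p-⁻¹ g rewrite U-sym g | ⁻¹-involutive g =
      cong (λ b → U g ∧ not b) (⌊⌋-⇔ (mk⇔ sym sym) (g ≟ g ⁻¹) (g ⁻¹ ≟ g))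
    fixpointFree : ∀ {g} → p g ≡ true → g ⁻¹ ≢ g
    fixpointFree {g} pg with g ⁻¹ ≟ g
    ... | yes _ = contradiction (trans (sym pg) (∧-zeroʳ (U g))) λ ()
    ... | no g⁻¹≢g = g⁻¹≢g
    ⁻¹-free : IsFreeInvolutionOn p _⁻¹
    ⁻¹-free = record
      { isInvolutionOn = record
          { closed     = λ {g} pg → trans (p-⁻¹ g) pg
          ; involutive = λ _ → ⁻¹-involutive _
          }
      ; fixpointFree   = fixpointFree
      }

  2∣count-selfInverse : 2 ∣ count U → 2 ∣ count (λ g → U g ∧ selfInverse g)
  2∣count-selfInverse 2∣|U| = ∣m+n∣m⇒∣n (subst (2 ∣_) |U|≡ 2∣|U|) 2∣count-nonSelfInverse
    where
    |U|≡ : count U ≡ count (λ g → U g ∧ not (selfInverse g)) + count (λ g → U g ∧ selfInverse g)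
    |U|≡ = trans (count-∧-not U selfInverse) (+-comm (count (λ g → U g ∧ selfInverse g)) _)

mainTheorem10 : (n : ℕ) (_∙_ : Fin n → Fin n → Fin n) (ε : Fin n) (_⁻¹ : Fin n → Fin n)
    → IsGroup _≡_ _∙_ ε _⁻¹
    → (U : Fin n → Bool)
    → (∀ g → U (g ⁻¹) ≡ U g)
    → U ε ≡ false
    → (Y Z : Fin n → Fin n → Bool)
    → IsSimpleGraph Y
    → IsSimpleGraph Z
    → (∀ g h → ind (U ((g ⁻¹) ∙ h)) ≡ sumFin n (λ k → ind (Y g k) * ind (Z k h)))
    → (t : ℕ) → n ≡ 2 * (2 * t + 1)
    → 2 ∣ countOrder2In n _∙_ ε U
mainTheorem10 n _∙_ ε _⁻¹ isGroup U U-sym ε∉U Y Z Y-simple Z-simple A≡Y*Z t n≡2[2t+1] =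
  subst (2 ∣_) (sym countOrder2≡count-selfInverse)
    (2∣count-selfInverse (4∣[2*[2*t+1]]*m⇒2∣m t (count U) 4∣n*|U|))
  where
  open CayleyGraph isGroup U U-sym ε∉U
  open Counting (↔-id (Fin n)) using (count)
  4∣arcs : 4 ∣ ∑[ g < n ] ∑[ h < n ] ind (cayley g h)
  4∣arcs = SimpleGraphFactorisation.4∣count-arcs cayley-isSimpleGraph Y-simple Z-simple
    (λ g h → trans (A≡Y*Z g h) (sumFin≡∑ n _))
  4∣n*|U| : 4 ∣ 2 * (2 * t + 1) * count U
  4∣n*|U| = subst (λ m → 4 ∣ m * count U) n≡2[2t+1] (subst (4 ∣_) count-arcs 4∣arcs)
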